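{- For every integer $r\ge 3$ and every integer $n>6^r$, $$g(r,n)\leq n-\frac{1}{12r}n^{\frac{r-1}{r}}.$$
   Context: A hypergraph is $r$-uniform if every edge has exactly $r$ vertices; an $r$-uniform hypergraph is $r$-partite if its vertex set can be partitioned into $r$ sets $V_1,\dots,V_r$ such that every edge contains exactly one vertex from each $V_i$. A matching is a set of pairwise vertex-disjoint edges. Given a collection (list) of matchings $M_1,\dots,M_n$ in a hypergraph (not necessarily disjoint from each other), a matching $M\subseteq \bigcup_{i=1}^n M_i$ is rainbow if there is an injection $\phi: M\to[n]$ such that every edge $e\in M$ belongs to $M_{\phi(e)}$. $g(r,n)$ denotes the largest $s$ such that every collection of $n$ matchings, each of size $n$, in an $r$-partite $r$-uniform hypergraph admits a rainbow matching of size $s$. -}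

module Defs where

open import Data.Nat using (ℕ; _≤_; _∸_; _*_; _^_)
open import Data.Fin using (Fin)
open import Data.Product using (Σ; _×_)
open import Relation.Binary.PropositionalEquality using (_≡_; _≢_)
open import Function.Definitions using (Injective)

-- An r-partite r-uniform hypergraph with parts V 0, …, V (r-1):
-- an edge picks exactly one vertex from each part.
Edge : (r : ℕ) → (Fin r → Set) → Set
Edge r V = (i : Fin r) → V i

-- Two edges are vertex-disjoint.  (Vertices in different parts are
-- distinct, so a common vertex can only occur within one part.)
Disjoint : {r : ℕ} {V : Fin r → Set} → Edge r V → Edge r V → Set
Disjoint e f = ∀ i → e i ≢ f i

record Matching (r : ℕ) (V : Fin r → Set) (m : ℕ) : Set where
  field
    edge     : Fin m → Edge r V
    disjoint : ∀ j k → j ≢ k → Disjoint (edge j) (edge k)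
open Matching public

record Rainbow (r : ℕ) (V : Fin r → Set) (n : ℕ)
               (M : Fin n → Matching r V n) (s : ℕ) : Set where
  field
    redge     : Fin s → Edge r V
    rdisjoint : ∀ j k → j ≢ k → Disjoint (redge j) (redge k)
    colour    : Fin s → Fin n
    colourInj : Injective _≡_ _≡_ colour
    member    : ∀ k → Σ (Fin n) λ t → edge (M (colour k)) t ≡ redge k

-- "every collection of n matchings, each of size n, in an r-partite
-- r-uniform hypergraph admits a rainbow matching of size s".
-- g(r,n) is the largest s with Admits r n s.
Admits : ℕ → ℕ → ℕ → Set₁
Admits r n s = (V : Fin r → Set) (M : Fin n → Matching r V n) → Rainbow r V n M s

-- s ≤ n − n^{(r-1)/r} / (12 r), cleared of roots and fractions:
-- equivalent to s ≤ n and n^{r-1} ≤ (12 r (n − s))^r.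
BelowBound : ℕ → ℕ → ℕ → Set
BelowBound r n s = s ≤ n × n ^ (r ∸ 1) ≤ ((n ∸ s) * (12 * r)) ^ r

{-# OPTIONS --safe #-}
module Submission where

-- Take a discrete torus with r cycles of lengths k or k + 1, where k^r ≤ n < (k + 1)^r and the first
-- cycle has even length, and add m dummy slots so that N + m = n for its volume N, with 5n ≤ 7N.  Every
-- vertex class is a copy of the torus plus the dummies.  The matching F consists of the edges (z, …, z)
-- over the torus points z, the matching G of the edges (z, g₁ z, …, g_{r-1} z), where g₁, g₃, …, g_{r-1}
-- are unit steps along the cycles 0, 3, …, r - 1 and g₂ steps along cycle 1 or cycle 2 according to the
-- parity of the first coordinate; both also contain the dummy edges (j, …, j).  The first ⌊n/2⌋ colours
-- carry G, the others F.  Let X and Y be the torus points used by the G- and F-edges of a rainbow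
-- matching of size s.  Disjointness gives Y ∩ gᵢ X = ∅, so for every i at most N - |X| - |Y| ≤ n - s
-- points of X leave X under gᵢ.  Steps along cycles 1 and 2 are recovered from g₂ and g₁ on slices of
-- alternating parity, so the edge boundary of X in the torus has size at most (r + 4)(n - s).  Since
-- |X| is about N/2, the isoperimetric inequality 4|X||Xᶜ| ≤ N (k + 1) |∂X| of the torus now forces
-- n ≤ 12 r k (n - s), and k^r ≤ n turns this into n^(r-1) ≤ (12 r (n - s))^r.

open import Defs
open import Data.Nat using (ℕ; zero; suc; _+_; _*_; _∸_; _^_; _≤_; _<_; z≤n; s≤s; z<s; >-nonZero; _<ᵇ_; ⌊_/2⌋)
open import Data.Nat.Properties
open import Data.Nat.Tactic.RingSolver using (solve-∀)
open import Algebra.Properties.CommutativeSemigroup +-commutativeSemigroup using ()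
  renaming (interchange to +-interchange)
open import Algebra.Properties.CommutativeSemigroup *-commutativeSemigroup using ()
  renaming (interchange to *-interchange; x∙yz≈y∙xz to *-left-comm)
open import Algebra.Properties.Semiring.Sum +-*-semiring
  using (sum; sum-syntax; sum-cong-≗; sum-remove; ∑-distrib-+; ∑-comm; sum-permute; *-distribˡ-sum; *-distribʳ-sum)
open import Data.Bool.Base using (Bool; true; false; not; _∧_; _∨_; if_then_else_)
open import Data.Bool.Properties using (∧-comm; not-involutive; not-injective)
open import Data.Empty using (⊥; ⊥-elim)
open import Data.Fin.Base using (Fin; zero; suc; toℕ; fromℕ; inject₁; _↑ˡ_; _↑ʳ_; combine)
open import Data.Fin.Induction using (<-weakInduction; <-weakInduction-startingFrom)
open import Data.Fin.Permutation using (Permutation′; permutation)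
open import Data.Fin.Properties as Finₚ using (1↔⊤; *↔×; +↔⊎; remQuot-combine; ≤fromℕ)
open import Data.Fin.Relation.Unary.Top using (view; ‵fromℕ; ‵inject₁; view-fromℕ; view-inject₁)
open import Data.Product.Base as Product using (∃-syntax; _×_; _,_; proj₁; proj₂)
open import Data.Product.Function.NonDependent.Propositional using (_×-↔_)
open import Data.Sum.Base as Sum using (_⊎_; inj₁; inj₂; [_,_]′)
open import Data.Sum.Function.Propositional using (_⊎-↔_)
open import Data.Sum.Properties using (inj₁-injective; inj₂-injective)
open import Data.Unit.Base using (⊤; tt)
open import Data.Vec.Base using (Vec; []; _∷_)
open import Data.Vec.Relation.Unary.All using (All; []; _∷_)
open import Function.Base using (_∘_; id)
open import Function.Bundles using (_↔_; Inverse; Injection; mk↔ₛ′)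
open import Function.Properties.Inverse using (↔-refl; ↔-sym; ↔-trans; ↔⇒↣)
open import Relation.Binary.PropositionalEquality
open import Relation.Nullary.Decidable using (does; yes; no)
open import Relation.Nullary.Negation using (¬_; contradiction)
open import Relation.Unary using (Decidable)

𝟙 : Bool → ℕ
𝟙 true  = 1
𝟙 false = 0

∑-mono-≤ : ∀ {n} {f g : Fin n → ℕ} → (∀ i → f i ≤ g i) → ∑[ i < n ] f i ≤ ∑[ i < n ] g i
∑-mono-≤ {zero}  f≤g = z≤n
∑-mono-≤ {suc n} f≤g = +-mono-≤ (f≤g zero) (∑-mono-≤ (f≤g ∘ suc))

∑-const : ∀ n c → ∑[ i < n ] c ≡ n * c
∑-const zero    c = refl
∑-const (suc n) c = cong (c +_) (∑-const n c)

∑-*ˡ : ∀ {n} c (f : Fin n → ℕ) → ∑[ i < n ] (c * f i) ≡ c * ∑[ i < n ] f i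
∑-*ˡ c f = sym (*-distribˡ-sum c f)

term≤∑ : ∀ {n} (f : Fin n → ℕ) i → f i ≤ ∑[ j < n ] f j
term≤∑ {suc n} f i = ≤-trans (m≤m+n (f i) _) (≤-reflexive (sym (sum-remove {i = i} f)))

∑-↑ : ∀ m {n} (f : Fin (m + n) → ℕ) →
      ∑[ p < m + n ] f p ≡ ∑[ i < m ] f (i ↑ˡ n) + ∑[ j < n ] f (m ↑ʳ j)
∑-↑ zero    f = refl
∑-↑ (suc m) {n} f = trans (cong (f zero +_) (∑-↑ m (f ∘ suc)))
  (sym (+-assoc (f zero) (∑[ i < m ] f (suc (i ↑ˡ n))) (∑[ j < n ] f (suc m ↑ʳ j))))

∑-combine : ∀ m {n} (f : Fin (m * n) → ℕ) →
            ∑[ p < m * n ] f p ≡ ∑[ i < m ] ∑[ j < n ] f (combine i j)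
∑-combine zero    f = refl
∑-combine (suc m) {n} f =
  trans (∑-↑ n f) (cong (∑[ j < n ] f (combine {suc m} zero j) +_) (∑-combine m {n} (f ∘ (n ↑ʳ_))))

∑-product : ∀ {m n} (f : Fin m → ℕ) (g : Fin n → ℕ) →
            ∑[ i < m ] f i * ∑[ j < n ] g j ≡ ∑[ i < m ] ∑[ j < n ] (f i * g j)
∑-product f g = trans (*-distribʳ-sum (sum g) f) (sum-cong-≗ λ i → *-distribˡ-sum (f i) g)

count : ∀ {n} → (Fin n → Bool) → ℕ
count {n} P = ∑[ i < n ] 𝟙 (P i)

_∖_ : ∀ {A : Set} → (A → Bool) → (A → Bool) → A → Bool
(P ∖ Q) a = P a ∧ not (Q a)

_∩_ : ∀ {A : Set} → (A → Bool) → (A → Bool) → A → Bool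
(P ∩ Q) a = P a ∧ Q a

𝟙≤1 : ∀ b → 𝟙 b ≤ 1
𝟙≤1 true  = ≤-refl
𝟙≤1 false = z≤n

𝟙-∧ : ∀ a b → 𝟙 (a ∧ b) ≡ 𝟙 a * 𝟙 b
𝟙-∧ true  b = sym (+-identityʳ (𝟙 b))
𝟙-∧ false b = refl

𝟙+𝟙-not : ∀ b → 𝟙 b + 𝟙 (not b) ≡ 1
𝟙+𝟙-not true  = refl
𝟙+𝟙-not false = refl

count+count∘not≡n : ∀ {n} (P : Fin n → Bool) → count P + count (not ∘ P) ≡ n
count+count∘not≡n {n} P = begin
  count P + count (not ∘ P)             ≡⟨ ∑-distrib-+ (𝟙 ∘ P) (𝟙 ∘ not ∘ P) ⟨
  ∑[ i < n ] (𝟙 (P i) + 𝟙 (not (P i))) ≡⟨ sum-cong-≗ (𝟙+𝟙-not ∘ P) ⟩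
  ∑[ i < n ] 1                    ≡⟨ ∑-const n 1 ⟩
  n * 1                           ≡⟨ *-identityʳ n ⟩
  n                               ∎
  where open ≡-Reasoning

count≡0 : ∀ {n} (P : Fin n → Bool) → (∀ i → P i ≡ false) → count P ≡ 0
count≡0 {n} P P≡false = trans (sum-cong-≗ (cong 𝟙 ∘ P≡false)) (trans (∑-const n 0) (*-zeroʳ n))

count≡0⇒false : ∀ {n} (P : Fin n → Bool) → count P ≡ 0 → ∀ i → P i ≡ false
count≡0⇒false P #P≡0 i with P i in Pi
... | false = refl
... | true  = contradiction (subst₂ _≤_ (cong 𝟙 Pi) #P≡0 (term≤∑ (𝟙 ∘ P) i)) λ ()

count*count≡∑∑ : ∀ {m n} (P : Fin m → Bool) (Q : Fin n → Bool) →
             count P * count Q ≡ ∑[ i < m ] ∑[ j < n ] 𝟙 (P i ∧ Q j)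
count*count≡∑∑ P Q = trans (∑-product (𝟙 ∘ P) (𝟙 ∘ Q)) (sum-cong-≗ λ i → sum-cong-≗ λ j → sym (𝟙-∧ (P i) (Q j)))

count≤n : ∀ {n} (P : Fin n → Bool) → count P ≤ n
count≤n P = ≤-trans (m≤m+n _ _) (≤-reflexive (count+count∘not≡n P))

count-cross-≤ : ∀ {n} (P Q : Fin n → Bool) →
                count P * count (not ∘ Q) ≤ count P * count (not ∘ P) + n * count (P ∖ Q)
count-cross-≤ {n} P Q = begin
  count P * count (not ∘ Q)                         ≤⟨ *-monoʳ-≤ (count P) Qᶜ≤Pᶜ+P∖Q ⟩
  count P * (count (not ∘ P) + count (P ∖ Q))       ≡⟨ *-distribˡ-+ (count P) (count (not ∘ P)) (count (P ∖ Q)) ⟩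
  count P * count (not ∘ P) + count P * count (P ∖ Q)
    ≤⟨ +-monoʳ-≤ (count P * count (not ∘ P)) (*-monoˡ-≤ (count (P ∖ Q)) (count≤n P)) ⟩
  count P * count (not ∘ P) + n * count (P ∖ Q)     ∎
  where
  open ≤-Reasoning
  pointwise : ∀ a b → 𝟙 (not b) ≤ 𝟙 (not a) + 𝟙 (a ∧ not b)
  pointwise true  true  = z≤n
  pointwise true  false = ≤-refl
  pointwise false true  = z≤n
  pointwise false false = s≤s z≤n
  Qᶜ≤Pᶜ+P∖Q : count (not ∘ Q) ≤ count (not ∘ P) + count (P ∖ Q)
  Qᶜ≤Pᶜ+P∖Q = ≤-trans (∑-mono-≤ λ i → pointwise (P i) (Q i))
                      (≤-reflexive (∑-distrib-+ (𝟙 ∘ not ∘ P) (𝟙 ∘ (P ∖ Q))))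

∑count*∑count∘not≤ : ∀ {k n} (P : Fin k → Fin n → Bool) →
                     ∑[ u < k ] count (P u) * ∑[ v < k ] count (not ∘ P v)
                     ≤ k * ∑[ u < k ] (count (P u) * count (not ∘ P u)) + n * ∑[ u < k ] ∑[ v < k ] count (P u ∖ P v)
∑count*∑count∘not≤ {k} {n} P = begin
  ∑[ u < k ] count (P u) * ∑[ v < k ] count (not ∘ P v)
    ≡⟨ ∑-product (count ∘ P) (λ v → count (not ∘ P v)) ⟩
  ∑[ u < k ] ∑[ v < k ] (count (P u) * count (not ∘ P v))
    ≤⟨ ∑-mono-≤ (λ u → ∑-mono-≤ λ v → count-cross-≤ (P u) (P v)) ⟩
  ∑[ u < k ] ∑[ v < k ] (A u + n * D u v)
    ≡⟨ sum-cong-≗ (λ u → trans (∑-distrib-+ (λ _ → A u) (λ v → n * D u v)) (cong₂ _+_ (∑-const k (A u)) (∑-*ˡ n (D u)))) ⟩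
  ∑[ u < k ] (k * A u + n * ∑[ v < k ] D u v)
    ≡⟨ trans (∑-distrib-+ (λ u → k * A u) (λ u → n * ∑[ v < k ] D u v))
             (cong₂ _+_ (∑-*ˡ k A) (∑-*ˡ n (λ u → ∑[ v < k ] D u v))) ⟩
  k * ∑[ u < k ] A u + n * ∑[ u < k ] ∑[ v < k ] D u v ∎
  where
  open ≤-Reasoning
  A : Fin k → ℕ
  A u = count (P u) * count (not ∘ P u)
  D : Fin k → Fin k → ℕ
  D u v = count (P u ∖ P v)

count∖+count∩≡count : ∀ {n} (P Q : Fin n → Bool) → count (P ∖ Q) + count (P ∩ Q) ≡ count P
count∖+count∩≡count P Q = trans (sym (∑-distrib-+ (𝟙 ∘ (P ∖ Q)) (𝟙 ∘ (P ∩ Q)))) (sum-cong-≗ λ i → split (P i) (Q i))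
  where
  split : ∀ a b → 𝟙 (a ∧ not b) + 𝟙 (a ∧ b) ≡ 𝟙 a
  split true  true  = refl
  split true  false = refl
  split false b     = refl

count-point : ∀ {n} (i : Fin n) → count (λ j → does (i Finₚ.≟ j)) ≡ 1
count-point {suc n} zero    = cong suc (count≡0 {n} (λ j → does (zero Finₚ.≟ suc j)) λ _ → refl)
count-point {suc n} (suc i) = count-point i

image : ∀ {s n} → (Fin s → Bool) → (Fin s → Fin n) → Fin n → Bool
image {zero}  P φ t = false
image {suc s} P φ t = (P zero ∧ does (φ zero Finₚ.≟ t)) ∨ image (P ∘ suc) (φ ∘ suc) t

image-sound : ∀ {s n} (P : Fin s → Bool) (φ : Fin s → Fin n) {t} → image P φ t ≡ true →
              ∃[ k ] P k ≡ true × φ k ≡ t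
image-sound {suc s} P φ {t} hit with P zero in P₀ | φ zero Finₚ.≟ t
... | true | yes φ₀≡t = zero , P₀ , φ₀≡t
... | true | no _  with k , Pk , φk≡t ← image-sound (P ∘ suc) (φ ∘ suc) hit = suc k , Pk , φk≡t
... | false | _   with k , Pk , φk≡t ← image-sound (P ∘ suc) (φ ∘ suc) hit = suc k , Pk , φk≡t

InjectiveOn : ∀ {s} {B : Set} → (Fin s → Bool) → (Fin s → B) → Set
InjectiveOn P φ = ∀ {k l} → P k ≡ true → P l ≡ true → φ k ≡ φ l → k ≡ l

count-image : ∀ {s n} (P : Fin s → Bool) (φ : Fin s → Fin n) → InjectiveOn P φ → count (image P φ) ≡ count P
count-image {zero} {n} P φ inj = count≡0 {n} (λ _ → false) λ _ → refl
count-image {suc s} {n} P φ inj = begin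
  count (image P φ)
    ≡⟨ sum-cong-≗ (λ t → 𝟙-∨ (first t) (image (P ∘ suc) (φ ∘ suc) t) (exclusive t)) ⟩
  ∑[ t < n ] (𝟙 (first t) + 𝟙 (image (P ∘ suc) (φ ∘ suc) t))
    ≡⟨ ∑-distrib-+ (𝟙 ∘ first) _ ⟩
  count first + count (image (P ∘ suc) (φ ∘ suc))
    ≡⟨ cong₂ _+_ count-first (count-image (P ∘ suc) (φ ∘ suc) (λ Pk Pl → Finₚ.suc-injective ∘ inj Pk Pl)) ⟩
  𝟙 (P zero) + count (P ∘ suc) ∎
  where
  open ≡-Reasoning
  first : Fin n → Bool
  first t = P zero ∧ does (φ zero Finₚ.≟ t)
  count-first : count first ≡ 𝟙 (P zero)
  count-first with P zero
  ... | true  = count-point (φ zero)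
  ... | false = count≡0 {n} (λ _ → false) λ _ → refl
  𝟙-∨ : ∀ a b → (a ≡ true → b ≡ true → ⊥) → 𝟙 (a ∨ b) ≡ 𝟙 a + 𝟙 b
  𝟙-∨ true  true  a⊥b = ⊥-elim (a⊥b refl refl)
  𝟙-∨ true  false _   = refl
  𝟙-∨ false b     _   = refl
  exclusive : ∀ t → first t ≡ true → image (P ∘ suc) (φ ∘ suc) t ≡ true → ⊥
  exclusive t first≡true hit with P zero in P₀ | φ zero Finₚ.≟ t
  ... | true | yes φ₀≡t with k , Pk , φk≡t ← image-sound (P ∘ suc) (φ ∘ suc) hit =
    contradiction (inj P₀ Pk (trans φ₀≡t (sym φk≡t))) λ ()

count-≤-injection : ∀ {s n} (P : Fin s → Bool) (Q : Fin n → Bool) (φ : Fin s → Fin n) → InjectiveOn P φ →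
                    (∀ k → P k ≡ true → Q (φ k) ≡ true) → count P ≤ count Q
count-≤-injection P Q φ inj P⇒Qφ = begin
  count P             ≡⟨ count-image P φ inj ⟨
  count (image P φ)   ≤⟨ ∑-mono-≤ (λ t → 𝟙-mono (into t)) ⟩
  count Q             ∎
  where
  open ≤-Reasoning
  𝟙-mono : ∀ {a b} → (a ≡ true → b ≡ true) → 𝟙 a ≤ 𝟙 b
  𝟙-mono {false} _   = z≤n
  𝟙-mono {true}  a⇒b rewrite a⇒b refl = ≤-refl
  into : ∀ t → image P φ t ≡ true → Q t ≡ true
  into t hit with k , Pk , refl ← image-sound P φ hit = P⇒Qφ k Pk

count-<ᵇ : ∀ {n a} → a ≤ n → count {n} (λ c → toℕ c <ᵇ a) ≡ a
count-<ᵇ {zero}  z≤n       = refl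
count-<ᵇ {suc n} z≤n       = count≡0 {suc n} (λ c → toℕ c <ᵇ 0) λ _ → refl
count-<ᵇ {suc n} (s≤s a≤n) = cong suc (count-<ᵇ a≤n)

-- The cycle

csuc : ∀ {c} → Fin (suc c) → Fin (suc c)
csuc i with view i
... | ‵fromℕ     = zero
... | ‵inject₁ j = suc j

cpred : ∀ {c} → Fin (suc c) → Fin (suc c)
cpred zero    = fromℕ _
cpred (suc j) = inject₁ j

csuc-fromℕ : ∀ c → csuc (fromℕ c) ≡ zero
csuc-fromℕ c rewrite view-fromℕ c = refl

csuc-inject₁ : ∀ {c} (j : Fin c) → csuc (inject₁ j) ≡ suc j
csuc-inject₁ j rewrite view-inject₁ j = refl

csuc-cpred : ∀ {c} (i : Fin (suc c)) → csuc (cpred i) ≡ i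
csuc-cpred zero    = csuc-fromℕ _
csuc-cpred (suc j) = csuc-inject₁ j

cpred-csuc : ∀ {c} (i : Fin (suc c)) → cpred (csuc i) ≡ i
cpred-csuc i with view i
... | ‵fromℕ     = refl
... | ‵inject₁ j = refl

rotation : ∀ {c} → Permutation′ (suc c)
rotation = permutation csuc cpred csuc-cpred cpred-csuc

∑-csuc : ∀ {c} (f : Fin (suc c) → ℕ) → ∑[ i < suc c ] f (csuc i) ≡ ∑[ i < suc c ] f i
∑-csuc f = sym (sum-permute f rotation)

csuc-closed : ∀ {c} (P : Fin (suc c) → Set) → (∀ i → P i → P (csuc i)) →
              ∀ {i} → P i → ∀ j → P j
csuc-closed {c} P step {i} Pi = <-weakInduction P P₀ forward
  where
  forward : ∀ j → P (inject₁ j) → P (suc j)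
  forward j = subst P (csuc-inject₁ j) ∘ step (inject₁ j)
  P₀ : P zero
  P₀ = subst P (csuc-fromℕ c) (step _ (<-weakInduction-startingFrom P Pi forward (≤fromℕ i)))

4mn≤[m+n]² : ∀ m n → 4 * (m * n) ≤ (m + n) * (m + n)
4mn≤[m+n]² m n = [ ordered , (λ n≤m → subst₂ _≤_ (cong (4 *_) (*-comm n m)) (cong (λ x → x * x) (+-comm n m))
                                                 (ordered n≤m)) ]′ (≤-total m n)
  where
  square : ∀ m o → (m + (m + o)) * (m + (m + o)) ≡ 4 * (m * (m + o)) + o * o
  square = solve-∀
  ordered : ∀ {m n} → m ≤ n → 4 * (m * n) ≤ (m + n) * (m + n)
  ordered {m} m≤n with o , refl ← m≤n⇒∃[o]m+o≡n m≤n = ≤-trans (m≤m+n _ _) (≤-reflexive (sym (square m o)))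

-- A set that no step of the cycle leaves is empty or everything; otherwise 4|X||Xᶜ| ≤ (|X| + |Xᶜ|)².
cycle-isoperimetric : ∀ {c} (X : Fin (suc c) → Bool) →
                      4 * (count X * count (not ∘ X)) ≤ suc c * suc c * count (X ∖ (X ∘ csuc))
cycle-isoperimetric {c} X with count (X ∖ (X ∘ csuc)) in ∂X
... | suc t = begin
  4 * (count X * count (not ∘ X))                            ≤⟨ 4mn≤[m+n]² (count X) (count (not ∘ X)) ⟩
  (count X + count (not ∘ X)) * (count X + count (not ∘ X))  ≡⟨ cong (λ k → k * k) (count+count∘not≡n X) ⟩
  suc c * suc c                                              ≤⟨ m≤m*n _ (suc t) ⟩
  suc c * suc c * suc t                                      ∎
  where open ≤-Reasoning
... | zero = ≤-trans (≤-reflexive (cong (4 *_) (constant (X zero) refl))) z≤n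
  where
  closed : ∀ u → X u ≡ true → X (csuc u) ≡ true
  closed u Xu with X (csuc u) in Xu⁺ | count≡0⇒false (X ∖ (X ∘ csuc)) ∂X u
  ... | true  | _ = refl
  ... | false | leaves rewrite Xu = contradiction leaves λ ()
  full : ∀ {u} → X u ≡ true → ∀ v → X v ≡ true
  full = csuc-closed (λ u → X u ≡ true) closed
  constant : ∀ b → X zero ≡ b → count X * count (not ∘ X) ≡ 0
  constant true  X₀ = trans (cong (count X *_) (count≡0 (not ∘ X) λ v → cong not (full X₀ v))) (*-zeroʳ (count X))
  constant false X₀ = cong (_* count (not ∘ X)) (count≡0 X empty)
    where
    empty : ∀ v → X v ≡ false
    empty v with X v in Xv
    ... | false = refl
    ... | true  = contradiction (trans (sym X₀) (full Xv zero)) λ ()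

Alternating : ∀ {c} → (Fin (suc c) → Bool) → Set
Alternating σ = ∀ u → σ (csuc u) ≡ not (σ u)

alternating-not : ∀ {c} {σ : Fin (suc c) → Bool} → Alternating σ → Alternating (not ∘ σ)
alternating-not alt u = cong not (alt u)

∑-alternating : ∀ {c} {σ : Fin (suc c) → Bool} → Alternating σ → (F : Fin (suc c) → ℕ) →
                ∑[ u < suc c ] (𝟙 (not (σ u)) * F u) ≡ ∑[ u < suc c ] (𝟙 (σ u) * F (csuc u))
∑-alternating {c} {σ} alt F = begin
  ∑[ u < suc c ] (𝟙 (not (σ u)) * F u)                 ≡⟨ ∑-csuc (λ u → 𝟙 (not (σ u)) * F u) ⟨
  ∑[ u < suc c ] (𝟙 (not (σ (csuc u))) * F (csuc u))   ≡⟨ sum-cong-≗ (λ u → cong (λ b → 𝟙 (not b) * F (csuc u)) (alt u)) ⟩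
  ∑[ u < suc c ] (𝟙 (not (not (σ u))) * F (csuc u))
    ≡⟨ sum-cong-≗ (λ u → cong (λ b → 𝟙 b * F (csuc u)) (not-involutive (σ u))) ⟩
  ∑[ u < suc c ] (𝟙 (σ u) * F (csuc u))                ∎
  where open ≡-Reasoning

∑≤2∑-alternating : ∀ {c} {σ : Fin (suc c) → Bool} → Alternating σ → (F Δ : Fin (suc c) → ℕ) →
                   (∀ u → F (csuc u) ≤ F u + Δ u) →
                   ∑[ u < suc c ] F u ≤ 2 * ∑[ u < suc c ] (𝟙 (σ u) * F u) + ∑[ u < suc c ] Δ u
∑≤2∑-alternating {c} {σ} alt F Δ F⁺≤F+Δ = begin
  ∑[ u < suc c ] F u
    ≡⟨ trans (sum-cong-≗ λ u → sym (split (σ u) (F u))) (∑-distrib-+ (λ u → 𝟙 (σ u) * F u) (λ u → 𝟙 (not (σ u)) * F u)) ⟩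
  S + ∑[ u < suc c ] (𝟙 (not (σ u)) * F u)
    ≡⟨ cong (S +_) (∑-alternating alt F) ⟩
  S + ∑[ u < suc c ] (𝟙 (σ u) * F (csuc u))
    ≤⟨ +-monoʳ-≤ S (∑-mono-≤ λ u → bound (σ u) {F u} {F (csuc u)} {Δ u} (F⁺≤F+Δ u)) ⟩
  S + ∑[ u < suc c ] (𝟙 (σ u) * F u + Δ u)
    ≡⟨ cong (S +_) (∑-distrib-+ (λ u → 𝟙 (σ u) * F u) Δ) ⟩
  S + (S + ∑[ u < suc c ] Δ u)
    ≡⟨ sym (+-assoc S S (∑[ u < suc c ] Δ u)) ⟩
  S + S + ∑[ u < suc c ] Δ u
    ≡⟨ cong (_+ ∑[ u < suc c ] Δ u) (cong (S +_) (sym (+-identityʳ S))) ⟩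
  2 * S + ∑[ u < suc c ] Δ u ∎
  where
  open ≤-Reasoning
  S = ∑[ u < suc c ] (𝟙 (σ u) * F u)
  split : ∀ b x → 𝟙 b * x + 𝟙 (not b) * x ≡ x
  split true  x = trans (+-identityʳ _) (+-identityʳ x)
  split false x = +-identityʳ x
  bound : ∀ b {x y δ} → y ≤ x + δ → 𝟙 b * y ≤ 𝟙 b * x + δ
  bound true  {x} {y} {δ} y≤x+δ = subst₂ (λ a b → a ≤ b + δ) (sym (+-identityʳ y)) (sym (+-identityʳ x)) y≤x+δ
  bound false y≤x+δ = z≤n

parity : ∀ {n} → Fin n → Bool
parity zero    = false
parity (suc i) = not (parity i)

parity-inject₁ : ∀ {n} (i : Fin n) → parity (inject₁ i) ≡ parity i
parity-inject₁ zero    = refl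
parity-inject₁ (suc i) = cong not (parity-inject₁ i)

parity-alternating : ∀ {c} → parity (fromℕ c) ≡ true → Alternating (parity {suc c})
parity-alternating {c} last-odd u with view u
... | ‵fromℕ     = cong not (sym last-odd)
... | ‵inject₁ j = cong not (sym (parity-inject₁ j))

-- The discrete torus

volume : ∀ {d} → Vec ℕ d → ℕ
volume []       = 1
volume (c ∷ cs) = suc c * volume cs

Grid : ∀ {d} → Vec ℕ d → Set
Grid []       = ⊤
Grid (c ∷ cs) = Fin (suc c) × Grid cs

grid↔ : ∀ {d} (cs : Vec ℕ d) → Grid cs ↔ Fin (volume cs)
grid↔ []       = ↔-sym 1↔⊤
grid↔ (c ∷ cs) = ↔-trans (↔-refl ×-↔ grid↔ cs) (↔-sym *↔×)

decode : ∀ {d} (cs : Vec ℕ d) → Fin (volume cs) → Grid cs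
decode cs = Inverse.from (grid↔ cs)

-- Sums over the torus are sums over its enumeration, so the lemmas on sums over Fin apply to them.
∑ᴳ : ∀ {d} (cs : Vec ℕ d) → (Grid cs → ℕ) → ℕ
∑ᴳ cs f = ∑[ p < volume cs ] f (decode cs p)

card : ∀ {d} (cs : Vec ℕ d) → (Grid cs → Bool) → ℕ
card cs X = count (X ∘ decode cs)

∑ᴳ-cons : ∀ {c d} (cs : Vec ℕ d) (f : Grid (c ∷ cs) → ℕ) →
          ∑ᴳ (c ∷ cs) f ≡ ∑[ u < suc c ] ∑ᴳ cs (λ z → f (u , z))
∑ᴳ-cons {c} cs f = trans (∑-combine (suc c) (f ∘ decode (c ∷ cs)))
  (sum-cong-≗ λ u → sum-cong-≗ λ q → cong (λ (u , q) → f (u , decode cs q)) (remQuot-combine u q))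

∑ᴳ-↔ : ∀ {d} (cs : Vec ℕ d) (h : Grid cs ↔ Grid cs) (f : Grid cs → ℕ) →
       ∑ᴳ cs (f ∘ Inverse.to h) ≡ ∑ᴳ cs f
∑ᴳ-↔ cs h f = sym (trans (sum-permute (f ∘ decode cs) π)
  (sum-cong-≗ λ p → cong f (Inverse.strictlyInverseʳ (grid↔ cs) (Inverse.to h (decode cs p)))))
  where
  π : Permutation′ (volume cs)
  π = ↔-trans (↔-sym (grid↔ cs)) (↔-trans h (grid↔ cs))

fibrewise : ∀ {c d} {cs : Vec ℕ d} → (Fin (suc c) → Grid cs ↔ Grid cs) → Grid (c ∷ cs) ↔ Grid (c ∷ cs)
fibrewise h = mk↔ₛ′ (λ (u , z) → u , Inverse.to (h u) z) (λ (u , z) → u , Inverse.from (h u) z)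
  (λ (u , z) → cong (u ,_) (Inverse.strictlyInverseˡ (h u) z))
  (λ (u , z) → cong (u ,_) (Inverse.strictlyInverseʳ (h u) z))

shift↔ : ∀ {d} (cs : Vec ℕ d) → Fin d → Grid cs ↔ Grid cs
shift↔ (c ∷ cs) zero    = rotation ×-↔ ↔-refl
shift↔ (c ∷ cs) (suc i) = fibrewise (λ _ → shift↔ cs i)

shift : ∀ {d} (cs : Vec ℕ d) → Fin d → Grid cs → Grid cs
shift cs i = Inverse.to (shift↔ cs i)

slice : ∀ {c d} {cs : Vec ℕ d} → (Grid (c ∷ cs) → Bool) → Fin (suc c) → Grid cs → Bool
slice X u z = X (u , z)

∂ : ∀ {d} (cs : Vec ℕ d) → (Grid cs → Grid cs) → (Grid cs → Bool) → ℕ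
∂ cs h X = card cs (X ∖ (X ∘ h))

∂ᵀ : ∀ {d} (cs : Vec ℕ d) → (Grid cs → Bool) → ℕ
∂ᵀ {d} cs X = ∑[ i < d ] ∂ cs (shift cs i) X

∂ᵀ-cons : ∀ {c d} (cs : Vec ℕ d) (X : Grid (c ∷ cs) → Bool) →
          ∂ᵀ (c ∷ cs) X ≡ ∂ (c ∷ cs) (shift (c ∷ cs) zero) X + ∑[ u < suc c ] ∂ᵀ cs (slice X u)
∂ᵀ-cons {c} {d} cs X = cong (∂ (c ∷ cs) (shift (c ∷ cs) zero) X +_) (begin
  ∑[ i < d ] ∂ (c ∷ cs) (shift (c ∷ cs) (suc i)) X
    ≡⟨ sum-cong-≗ (λ i → ∑ᴳ-cons cs (𝟙 ∘ (X ∖ (X ∘ shift (c ∷ cs) (suc i))))) ⟩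
  ∑[ i < d ] ∑[ u < suc c ] ∂ cs (shift cs i) (slice X u)
    ≡⟨ ∑-comm (λ i u → ∂ cs (shift cs i) (slice X u)) ⟩
  ∑[ u < suc c ] ∂ᵀ cs (slice X u) ∎)
  where open ≡-Reasoning

module _ {d} (cs : Vec ℕ d) (h : Grid cs ↔ Grid cs) where
  private
    hᵗ = Inverse.to h

  ∂-reverse : (X : Grid cs → Bool) → card cs ((X ∘ hᵗ) ∖ X) ≡ ∂ cs hᵗ X
  ∂-reverse X = +-cancelʳ-≡ (card cs (X ∩ (X ∘ hᵗ))) _ _ (begin
    card cs ((X ∘ hᵗ) ∖ X) + card cs (X ∩ (X ∘ hᵗ))
      ≡⟨ cong (card cs ((X ∘ hᵗ) ∖ X) +_) (sum-cong-≗ λ p → cong 𝟙 (∧-comm (X (decode cs p)) _)) ⟩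
    card cs ((X ∘ hᵗ) ∖ X) + card cs ((X ∘ hᵗ) ∩ X)  ≡⟨ count∖+count∩≡count (X ∘ hᵗ ∘ decode cs) (X ∘ decode cs) ⟩
    card cs (X ∘ hᵗ)                                 ≡⟨ ∑ᴳ-↔ cs h (𝟙 ∘ X) ⟩
    card cs X                                        ≡⟨ count∖+count∩≡count (X ∘ decode cs) (X ∘ hᵗ ∘ decode cs) ⟨
    card cs (X ∖ (X ∘ hᵗ)) + card cs (X ∩ (X ∘ hᵗ))  ∎)
    where open ≡-Reasoning

  ∂-lipschitz : (A B : Grid cs → Bool) → ∂ cs hᵗ B ≤ ∂ cs hᵗ A + (card cs (B ∖ A) + card cs (A ∖ B))
  ∂-lipschitz A B = begin
    ∂ cs hᵗ B
      ≤⟨ ∑-mono-≤ (λ p → pointwise (A (decode cs p)) (A (hᵗ (decode cs p))) (B (decode cs p)) (B (hᵗ (decode cs p)))) ⟩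
    ∑ᴳ cs (λ z → 𝟙 ((A ∖ (A ∘ hᵗ)) z) + (𝟙 ((B ∖ A) z) + 𝟙 ((A ∖ B) (hᵗ z))))
      ≡⟨ trans (∑-distrib-+ (𝟙 ∘ (A ∖ (A ∘ hᵗ)) ∘ decode cs) _)
               (cong (∂ cs hᵗ A +_) (∑-distrib-+ (𝟙 ∘ (B ∖ A) ∘ decode cs) _)) ⟩
    ∂ cs hᵗ A + (card cs (B ∖ A) + ∑ᴳ cs (𝟙 ∘ (A ∖ B) ∘ hᵗ))
      ≡⟨ cong (λ t → ∂ cs hᵗ A + (card cs (B ∖ A) + t)) (∑ᴳ-↔ cs h (𝟙 ∘ (A ∖ B))) ⟩
    ∂ cs hᵗ A + (card cs (B ∖ A) + card cs (A ∖ B)) ∎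
    where
    open ≤-Reasoning
    pointwise : ∀ a a' b b' → 𝟙 (b ∧ not b') ≤ 𝟙 (a ∧ not a') + (𝟙 (b ∧ not a) + 𝟙 (a' ∧ not b'))
    pointwise a     a'    false b'    = z≤n
    pointwise a     a'    true  true  = z≤n
    pointwise false a'    true  false = s≤s z≤n
    pointwise true  false true  false = s≤s z≤n
    pointwise true  true  true  false = s≤s z≤n

slice-differences≤∂₀ : ∀ {c d} (cs : Vec ℕ d) (X : Grid (c ∷ cs) → Bool) →
                 4 * ∑[ u < suc c ] ∑[ v < suc c ] card cs ((slice X u) ∖ (λ z → X (v , z)))
                 ≤ suc c * suc c * ∂ (c ∷ cs) (shift (c ∷ cs) zero) X
slice-differences≤∂₀ {c} cs X = begin
  4 * ∑[ u < k ] ∑[ v < k ] ∑[ p < N ] 𝟙 (Xᵖ p u ∧ not (Xᵖ p v))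
    ≡⟨ cong (4 *_) (trans (sum-cong-≗ λ u → ∑-comm (λ v p → 𝟙 (Xᵖ p u ∧ not (Xᵖ p v))))
                          (∑-comm (λ u p → ∑[ v < k ] 𝟙 (Xᵖ p u ∧ not (Xᵖ p v))))) ⟩
  4 * ∑[ p < N ] ∑[ u < k ] ∑[ v < k ] 𝟙 (Xᵖ p u ∧ not (Xᵖ p v))
    ≡⟨ cong (4 *_) (sum-cong-≗ λ p → sym (count*count≡∑∑ (Xᵖ p) (not ∘ Xᵖ p))) ⟩
  4 * ∑[ p < N ] (count (Xᵖ p) * count (not ∘ Xᵖ p))
    ≡⟨ ∑-*ˡ 4 (λ p → count (Xᵖ p) * count (not ∘ Xᵖ p)) ⟨
  ∑[ p < N ] (4 * (count (Xᵖ p) * count (not ∘ Xᵖ p)))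
    ≤⟨ ∑-mono-≤ (λ p → cycle-isoperimetric (Xᵖ p)) ⟩
  ∑[ p < N ] (k * k * count (Xᵖ p ∖ (Xᵖ p ∘ csuc)))
    ≡⟨ ∑-*ˡ (k * k) (λ p → count (Xᵖ p ∖ (Xᵖ p ∘ csuc))) ⟩
  k * k * ∑[ p < N ] ∑[ u < k ] 𝟙 ((Xᵖ p ∖ (Xᵖ p ∘ csuc)) u)
    ≡⟨ cong (k * k *_) (trans (∑-comm (λ p u → 𝟙 ((Xᵖ p ∖ (Xᵖ p ∘ csuc)) u)))
                               (sym (∑ᴳ-cons cs (𝟙 ∘ (X ∖ (X ∘ shift (c ∷ cs) zero)))))) ⟩
  k * k * ∂ (c ∷ cs) (shift (c ∷ cs) zero) X ∎
  where
  open ≤-Reasoning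
  k = suc c
  N = volume cs
  Xᵖ : Fin N → Fin k → Bool
  Xᵖ p u = X (u , decode cs p)

-- Induction on the dimension: the cross terms between two slices are compared point by point along the
-- first cycle, where the one-dimensional inequality applies.
torus-isoperimetric : ∀ {d} K (cs : Vec ℕ d) → All (λ c → suc c ≤ K) cs → (X : Grid cs → Bool) →
                      4 * (card cs X * card cs (not ∘ X)) ≤ volume cs * (K * ∂ᵀ cs X)
torus-isoperimetric K [] [] X with X tt
... | true  = z≤n
... | false = z≤n
torus-isoperimetric K (c ∷ cs) (k≤K ∷ cs≤K) X = begin
  4 * (card (c ∷ cs) X * card (c ∷ cs) (not ∘ X))
    ≡⟨ cong₂ (λ a b → 4 * (a * b)) (∑ᴳ-cons cs (𝟙 ∘ X)) (∑ᴳ-cons cs (𝟙 ∘ not ∘ X)) ⟩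
  4 * (∑[ u < k ] card cs (slice X u) * ∑[ v < k ] card cs (not ∘ slice X v))
    ≤⟨ *-monoʳ-≤ 4 (∑count*∑count∘not≤ (λ u → slice X u ∘ decode cs)) ⟩
  4 * (k * ∑[ u < k ] A u + N * D)
    ≡⟨ trans (distribute k (∑[ u < k ] A u) N D) (cong (λ t → k * t + N * (4 * D)) (sym (∑-*ˡ 4 A))) ⟩
  k * ∑[ u < k ] (4 * A u) + N * (4 * D)
    ≤⟨ +-mono-≤ (*-monoʳ-≤ k (∑-mono-≤ λ u → torus-isoperimetric K cs cs≤K (slice X u)))
                (*-monoʳ-≤ N (slice-differences≤∂₀ cs X)) ⟩
  k * ∑[ u < k ] (N * (K * B u)) + N * (k * k * ∂₀)
    ≤⟨ +-monoʳ-≤ (k * ∑[ u < k ] (N * (K * B u))) (*-monoʳ-≤ N (*-monoˡ-≤ ∂₀ (*-monoʳ-≤ k k≤K))) ⟩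
  k * ∑[ u < k ] (N * (K * B u)) + N * (k * K * ∂₀)
    ≡⟨ cong (λ t → k * t + N * (k * K * ∂₀)) (trans (∑-*ˡ N (λ u → K * B u)) (cong (N *_) (∑-*ˡ K B))) ⟩
  k * (N * (K * ∑[ u < k ] B u)) + N * (k * K * ∂₀)
    ≡⟨ collect k N K (∑[ u < k ] B u) ∂₀ ⟩
  k * N * (K * (∂₀ + ∑[ u < k ] B u))
    ≡⟨ cong (λ t → k * N * (K * t)) (∂ᵀ-cons cs X) ⟨
  k * N * (K * ∂ᵀ (c ∷ cs) X) ∎
  where
  open ≤-Reasoning
  k = suc c
  N = volume cs
  A B : Fin k → ℕ
  A u = card cs (slice X u) * card cs (not ∘ slice X u)
  B u = ∂ᵀ cs (slice X u)
  D = ∑[ u < k ] ∑[ v < k ] card cs (slice X u ∖ slice X v)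
  ∂₀ = ∂ (c ∷ cs) (shift (c ∷ cs) zero) X
  distribute : ∀ k a N d → 4 * (k * a + N * d) ≡ k * (4 * a) + N * (4 * d)
  distribute = solve-∀
  collect : ∀ k N K b e → k * (N * (K * b)) + N * (k * K * e) ≡ k * N * (K * (e + b))
  collect = solve-∀

diagonal↔ : ∀ {c₀ c₁ c₂ d} {cs : Vec ℕ d} → (Fin (suc c₀) → Bool) →
            Grid (c₀ ∷ c₁ ∷ c₂ ∷ cs) ↔ Grid (c₀ ∷ c₁ ∷ c₂ ∷ cs)
diagonal↔ {cs = cs} σ = fibrewise (λ u → shift↔ (_ ∷ _ ∷ cs) (if σ u then suc zero else zero))

∑-slice-differences≡2∂₀ : ∀ {c d} (cs : Vec ℕ d) (X : Grid (c ∷ cs) → Bool) →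
  ∑[ u < suc c ] (card cs (slice X (csuc u) ∖ slice X u) + card cs (slice X u ∖ slice X (csuc u)))
  ≡ 2 * ∂ (c ∷ cs) (shift (c ∷ cs) zero) X
∑-slice-differences≡2∂₀ {c} cs X = begin
  ∑[ u < suc c ] (card cs (slice X (csuc u) ∖ slice X u) + card cs (slice X u ∖ slice X (csuc u)))
    ≡⟨ ∑-distrib-+ (λ u → card cs (slice X (csuc u) ∖ slice X u)) (λ u → card cs (slice X u ∖ slice X (csuc u))) ⟩
  ∑[ u < suc c ] card cs (slice X (csuc u) ∖ slice X u) + ∑[ u < suc c ] card cs (slice X u ∖ slice X (csuc u))
    ≡⟨ cong₂ _+_ (∑ᴳ-cons cs (𝟙 ∘ ((X ∘ shift G zero) ∖ X))) (∑ᴳ-cons cs (𝟙 ∘ (X ∖ (X ∘ shift G zero)))) ⟨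
  card G ((X ∘ shift G zero) ∖ X) + ∂ G (shift G zero) X
    ≡⟨ cong (_+ ∂ G (shift G zero) X) (∂-reverse G (shift↔ G zero) X) ⟩
  ∂ G (shift G zero) X + ∂ G (shift G zero) X
    ≡⟨ cong (∂ G (shift G zero) X +_) (+-identityʳ (∂ G (shift G zero) X)) ⟨
  2 * ∂ G (shift G zero) X ∎
  where
  open ≡-Reasoning
  G = c ∷ cs

∂-diagonal : ∀ {c₀ c₁ c₂ d} (cs : Vec ℕ d) (σ : Fin (suc c₀) → Bool) → let G′ = c₁ ∷ c₂ ∷ cs in
  (X : Grid (c₀ ∷ G′) → Bool) →
  ∂ (c₀ ∷ G′) (Inverse.to (diagonal↔ σ)) X
  ≡ ∑[ u < suc c₀ ] (𝟙 (not (σ u)) * ∂ G′ (shift G′ zero) (slice X u))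
    + ∑[ u < suc c₀ ] (𝟙 (σ u) * ∂ G′ (shift G′ (suc zero)) (slice X u))
∂-diagonal {c₀} {c₁} {c₂} cs σ X =
  trans (∑ᴳ-cons G′ (𝟙 ∘ (X ∖ (X ∘ Inverse.to (diagonal↔ σ)))))
        (trans (sum-cong-≗ λ u → fibre (σ u) (slice X u))
               (∑-distrib-+ (λ u → 𝟙 (not (σ u)) * ∂ G′ (shift G′ zero) (slice X u))
                            (λ u → 𝟙 (σ u) * ∂ G′ (shift G′ (suc zero)) (slice X u))))
  where
  G′ = c₁ ∷ c₂ ∷ cs
  fibre : ∀ b (Y : Grid G′ → Bool) → ∂ G′ (shift G′ (if b then suc zero else zero)) Y
          ≡ 𝟙 (not b) * ∂ G′ (shift G′ zero) Y + 𝟙 b * ∂ G′ (shift G′ (suc zero)) Y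
  fibre true  Y = sym (+-identityʳ _)
  fibre false Y = sym (trans (+-identityʳ _) (+-identityʳ _))

-- Passing to an adjacent slice changes the boundary in a fixed direction by at most the difference of
-- the two slices, so the slices of either parity control the boundary on all slices.
∂₁+∂₂≤2∂diagonal+4∂₀ : ∀ {c₀ c₁ c₂ d} (cs : Vec ℕ d) {σ : Fin (suc c₀) → Bool} → Alternating σ →
  let G = c₀ ∷ c₁ ∷ c₂ ∷ cs in (X : Grid G → Bool) →
  ∂ G (shift G (suc zero)) X + ∂ G (shift G (suc (suc zero))) X
  ≤ 2 * ∂ G (Inverse.to (diagonal↔ σ)) X + 4 * ∂ G (shift G zero) X
∂₁+∂₂≤2∂diagonal+4∂₀ {c₀} {c₁} {c₂} cs {σ} alt X = begin
  ∂ G (shift G (suc zero)) X + ∂ G (shift G (suc (suc zero))) X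
    ≡⟨ cong₂ _+_ (∑ᴳ-cons G′ (𝟙 ∘ (X ∖ (X ∘ shift G (suc zero)))))
                 (∑ᴳ-cons G′ (𝟙 ∘ (X ∖ (X ∘ shift G (suc (suc zero)))))) ⟩
  ∑[ u < k ] E zero u + ∑[ u < k ] E (suc zero) u
    ≤⟨ +-mono-≤ (∑≤2∑-alternating (alternating-not alt) (E zero) Δ (lipschitz zero))
                (∑≤2∑-alternating alt (E (suc zero)) Δ (lipschitz (suc zero))) ⟩
  (2 * ∑[ u < k ] (𝟙 (not (σ u)) * E zero u) + ∑Δ) + (2 * ∑[ u < k ] (𝟙 (σ u) * E (suc zero) u) + ∑Δ)
    ≡⟨ rearrange (∑[ u < k ] (𝟙 (not (σ u)) * E zero u)) (∑[ u < k ] (𝟙 (σ u) * E (suc zero) u)) ∑Δ ⟩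
  2 * (∑[ u < k ] (𝟙 (not (σ u)) * E zero u) + ∑[ u < k ] (𝟙 (σ u) * E (suc zero) u)) + 2 * ∑Δ
    ≡⟨ cong₂ (λ a b → 2 * a + 2 * b) (sym (∂-diagonal cs σ X)) (∑-slice-differences≡2∂₀ G′ X) ⟩
  2 * ∂ G (Inverse.to (diagonal↔ σ)) X + 2 * (2 * ∂ G (shift G zero) X)
    ≡⟨ cong (2 * ∂ G (Inverse.to (diagonal↔ σ)) X +_) (*-assoc 2 2 (∂ G (shift G zero) X)) ⟨
  2 * ∂ G (Inverse.to (diagonal↔ σ)) X + 4 * ∂ G (shift G zero) X ∎
  where
  open ≤-Reasoning
  G′ = c₁ ∷ c₂ ∷ cs
  G = c₀ ∷ G′
  k = suc c₀
  E : Fin (suc (suc _)) → Fin k → ℕ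
  E i u = ∂ G′ (shift G′ i) (slice X u)
  Δ : Fin k → ℕ
  Δ u = card G′ (slice X (csuc u) ∖ slice X u) + card G′ (slice X u ∖ slice X (csuc u))
  ∑Δ = ∑[ u < k ] Δ u
  lipschitz : ∀ i u → E i (csuc u) ≤ E i u + Δ u
  lipschitz i u = ∂-lipschitz G′ (shift↔ G′ i) (slice X u) (slice X (csuc u))
  rearrange : ∀ a b e → (2 * a + e) + (2 * b + e) ≡ 2 * (a + b) + 2 * e
  rearrange = solve-∀

-- Matchings along bijections of the torus

matching-from : ∀ {r n} {V : Fin r → Set} {A : Set} → Fin n ↔ A → (e : A → Edge r V) →
                (∀ i {a b} → e a i ≡ e b i → a ≡ b) → Matching r V n
matching-from slots e e-injective = record
  { edge     = e ∘ Inverse.to slots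
  ; disjoint = λ j k j≢k i eq → j≢k (Injection.injective (↔⇒↣ slots) (e-injective i eq))
  }

module TorusCollection {q d} (cs : Vec ℕ d) (m : ℕ) (g : Fin (suc q) → Grid cs ↔ Grid cs) where

  N : ℕ
  N = volume cs

  Slot : Set
  Slot = Grid cs ⊎ Fin m

  Vertex : Fin (suc q) → Set
  Vertex _ = Slot

  slots : Fin (N + m) ↔ Slot
  slots = ↔-trans +↔⊎ (↔-sym (grid↔ cs) ⊎-↔ ↔-refl)

  ∑-slots : (f : Fin (N + m) → ℕ) →
            ∑[ t < N + m ] f t ≡ ∑ᴳ cs (f ∘ Inverse.from slots ∘ inj₁) + ∑[ j < m ] f (Inverse.from slots (inj₂ j))
  ∑-slots f = trans (∑-↑ N f) (cong (_+ ∑[ j < m ] f (N ↑ʳ j))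
    (sum-cong-≗ λ p → cong (λ p′ → f (p′ ↑ˡ m)) (sym (Inverse.strictlyInverseˡ (grid↔ cs) p))))

  edgeAlong : (Fin (suc q) → Grid cs ↔ Grid cs) → Slot → Edge (suc q) Vertex
  edgeAlong h (inj₁ z) i = inj₁ (Inverse.to (h i) z)
  edgeAlong h (inj₂ j) i = inj₂ j

  along : (Fin (suc q) → Grid cs ↔ Grid cs) → Matching (suc q) Vertex (N + m)
  along h = matching-from slots (edgeAlong h) injective
    where
    injective : ∀ i {a b} → edgeAlong h a i ≡ edgeAlong h b i → a ≡ b
    injective i {inj₁ z} {inj₁ w} eq = cong inj₁ (Injection.injective (↔⇒↣ (h i)) (inj₁-injective eq))
    injective i {inj₂ j} {inj₂ l} eq = cong inj₂ (inj₂-injective eq)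

  maps : Bool → Fin (suc q) → Grid cs ↔ Grid cs
  maps b = if b then g else λ _ → ↔-refl

  collection : ℕ → Fin (N + m) → Matching (suc q) Vertex (N + m)
  collection a c = along (maps (toℕ c <ᵇ a))

  record RainbowBounds (a s : ℕ) : Set where
    field
      X       : Grid cs → Bool
      y       : ℕ
      x≤a     : card cs X ≤ a
      y+a≤n   : y + a ≤ N + m
      s≤x+y+m : s ≤ card cs X + y + m
      x+y+∂≤N : ∀ i → card cs X + y + ∂ cs (Inverse.to (g i)) X ≤ N

  module Analysis (g₀≗id : ∀ z → Inverse.to (g zero) z ≡ z) {a s} (a≤n : a ≤ N + m)
                  (R : Rainbow (suc q) Vertex (N + m) (collection a) s) where
    open Rainbow R

    inG : Fin s → Bool
    inG k = toℕ (colour k) <ᵇ a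

    index : Fin s → Fin (N + m)
    index k = proj₁ (member k)

    slot : Fin s → Slot
    slot k = Inverse.to slots (index k)

    redge≡ : ∀ k → redge k ≡ edgeAlong (maps (inG k)) (slot k)
    redge≡ k = sym (proj₂ (member k))

    distinct : ∀ {k l} → redge k ≡ redge l → k ≡ l
    distinct {k} {l} eq with k Finₚ.≟ l
    ... | yes k≡l = k≡l
    ... | no  k≢l = ⊥-elim (rdisjoint k l k≢l zero (cong (λ e → e zero) eq))

    same-class : ∀ {k l} → inG k ≡ inG l → index k ≡ index l → k ≡ l
    same-class {k} {l} Gk≡Gl ik≡il =
      distinct (trans (redge≡ k) (trans (cong₂ (λ b t → edgeAlong (maps b) (Inverse.to slots t)) Gk≡Gl ik≡il)
                                        (sym (redge≡ l))))

    index-injectiveᴳ : InjectiveOn inG index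
    index-injectiveᴳ Gk Gl = same-class (trans Gk (sym Gl))

    index-injectiveᶠ : InjectiveOn (not ∘ inG) index
    index-injectiveᶠ Fk Fl = same-class (not-injective (trans Fk (sym Fl)))

    classes-differ : ∀ {k l} → inG k ≡ true → not (inG l) ≡ true → k ≢ l
    classes-differ Gk Fl refl = contradiction (trans (sym Gk) (not-injective Fl)) λ ()

    occupied : (Fin s → Bool) → Slot → Bool
    occupied P = image P index ∘ Inverse.from slots

    X Y : Grid cs → Bool
    X = occupied inG ∘ inj₁
    Y = occupied (not ∘ inG) ∘ inj₁

    occupant : ∀ P {q} → occupied P q ≡ true → ∃[ k ] P k ≡ true × slot k ≡ q
    occupant P {q} occ with k , Pk , ik≡ ← image-sound P index occ =
      k , Pk , trans (cong (Inverse.to slots) ik≡) (Inverse.strictlyInverseˡ slots q)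

    conflict : ∀ i {v z} → X v ≡ true → Y z ≡ true → Inverse.to (g i) v ≡ z → ⊥
    conflict i {v} {z} Xv Yz gv≡z
      with k , Gk , k↦v ← occupant inG Xv | l , Fl , l↦z ← occupant (not ∘ inG) Yz =
      rdisjoint k l (classes-differ Gk Fl) i (begin
        redge k i                            ≡⟨ cong (λ e → e i) (redge≡ k) ⟩
        edgeAlong (maps (inG k)) (slot k) i  ≡⟨ cong₂ (λ b q → edgeAlong (maps b) q i) Gk k↦v ⟩
        inj₁ (Inverse.to (g i) v)            ≡⟨ cong inj₁ gv≡z ⟩
        inj₁ z                               ≡⟨ cong₂ (λ b q → edgeAlong (maps b) q i) (not-injective Fl) l↦z ⟨
        edgeAlong (maps (inG l)) (slot l) i  ≡⟨ cong (λ e → e i) (redge≡ l) ⟨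
        redge l i                            ∎)
      where open ≡-Reasoning

    x+y+∂≤N : ∀ i → card cs X + card cs Y + ∂ cs (Inverse.to (g i)) X ≤ N
    x+y+∂≤N i = begin
      card cs X + card cs Y + ∂ cs h X
        ≡⟨ cong₂ (λ p q → p + q + ∂ cs h X) (∑ᴳ-↔ cs (g i) (𝟙 ∘ X)) (∑ᴳ-↔ cs (g i) (𝟙 ∘ Y)) ⟨
      ∑ᴳ cs (𝟙 ∘ X ∘ h) + ∑ᴳ cs (𝟙 ∘ Y ∘ h) + ∂ cs h X
        ≡⟨ trans (cong (_+ ∂ cs h X) (sym (∑-distrib-+ (𝟙 ∘ X ∘ h ∘ decode cs) _)))
                 (sym (∑-distrib-+ _ (𝟙 ∘ (X ∖ (X ∘ h)) ∘ decode cs))) ⟩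
      ∑ᴳ cs (λ z → 𝟙 (X (h z)) + 𝟙 (Y (h z)) + 𝟙 (X z ∧ not (X (h z))))
        ≤⟨ ∑-mono-≤ (λ p → pointwise (decode cs p)) ⟩
      ∑[ p < N ] 1
        ≡⟨ trans (∑-const N 1) (*-identityʳ N) ⟩
      N ∎
      where
      open ≤-Reasoning
      h = Inverse.to (g i)
      pointwise : ∀ z → 𝟙 (X (h z)) + 𝟙 (Y (h z)) + 𝟙 (X z ∧ not (X (h z))) ≤ 1
      pointwise z with Y (h z) in Yhz | X (h z) in Xhz | X z in Xz
      ... | false | false | b     = 𝟙≤1 (b ∧ true)
      ... | false | true  | true  = ≤-refl
      ... | false | true  | false = ≤-refl
      ... | true  | true  | _     = ⊥-elim (conflict zero Xhz Yhz (g₀≗id (h z)))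
      ... | true  | false | true  = ⊥-elim (conflict i Xz Yhz refl)
      ... | true  | false | false = ≤-refl

    extra : (Fin s → Bool) → ℕ
    extra P = ∑[ j < m ] 𝟙 (occupied P (inj₂ j))

    count≡card+extra : ∀ P → InjectiveOn P index → count P ≡ card cs (occupied P ∘ inj₁) + extra P
    count≡card+extra P injective = trans (sym (count-image P index injective)) (∑-slots (𝟙 ∘ image P index))

    extra-exclusive : ∀ j → 𝟙 (occupied inG (inj₂ j)) + 𝟙 (occupied (not ∘ inG) (inj₂ j)) ≤ 1
    extra-exclusive j with occupied inG (inj₂ j) in G | occupied (not ∘ inG) (inj₂ j) in F
    ... | false | b     = 𝟙≤1 b
    ... | true  | false = ≤-refl
    ... | true  | true with k , Gk , k↦j ← occupant inG G | l , Fl , l↦j ← occupant (not ∘ inG) F =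
      ⊥-elim (classes-differ Gk Fl k≡l)
      where
      open ≡-Reasoning
      k≡l : k ≡ l
      k≡l = distinct (begin
        redge k                            ≡⟨ redge≡ k ⟩
        edgeAlong (maps (inG k)) (slot k)  ≡⟨ cong (edgeAlong (maps (inG k))) k↦j ⟩
        (λ _ → inj₂ j)                     ≡⟨ cong (edgeAlong (maps (inG l))) l↦j ⟨
        edgeAlong (maps (inG l)) (slot l)  ≡⟨ redge≡ l ⟨
        redge l                            ∎)

    extra≤m : extra inG + extra (not ∘ inG) ≤ m
    extra≤m = begin
      extra inG + extra (not ∘ inG)
        ≡⟨ ∑-distrib-+ (λ j → 𝟙 (occupied inG (inj₂ j))) (λ j → 𝟙 (occupied (not ∘ inG) (inj₂ j))) ⟨
      ∑[ j < m ] (𝟙 (occupied inG (inj₂ j)) + 𝟙 (occupied (not ∘ inG) (inj₂ j)))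
        ≤⟨ ∑-mono-≤ extra-exclusive ⟩
      ∑[ j < m ] 1
        ≡⟨ trans (∑-const m 1) (*-identityʳ m) ⟩
      m ∎
      where open ≤-Reasoning

    count-inG≤a : count inG ≤ a
    count-inG≤a = ≤-trans (count-≤-injection inG _ colour (λ _ _ → colourInj) (λ _ Gk → Gk)) (≤-reflexive (count-<ᵇ a≤n))

    count-not-inG+a≤n : count (not ∘ inG) + a ≤ N + m
    count-not-inG+a≤n = begin
      count (not ∘ inG) + a
        ≤⟨ +-mono-≤ (count-≤-injection (not ∘ inG) (not ∘ below) colour (λ _ _ → colourInj) (λ _ Fk → Fk))
                    (≤-reflexive (sym (count-<ᵇ a≤n))) ⟩
      count (not ∘ below) + count below  ≡⟨ +-comm (count (not ∘ below)) (count below) ⟩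
      count below + count (not ∘ below)  ≡⟨ count+count∘not≡n below ⟩
      N + m                              ∎
      where
      open ≤-Reasoning
      below : Fin (N + m) → Bool
      below c = toℕ c <ᵇ a

    s≤x+y+m : s ≤ card cs X + card cs Y + m
    s≤x+y+m = begin
      s                                                            ≡⟨ count+count∘not≡n inG ⟨
      count inG + count (not ∘ inG)                                ≡⟨ cong₂ _+_ (count≡card+extra inG index-injectiveᴳ)
                                                                                (count≡card+extra (not ∘ inG) index-injectiveᶠ) ⟩
      (card cs X + extra inG) + (card cs Y + extra (not ∘ inG))   ≡⟨ +-interchange (card cs X) (extra inG) (card cs Y) _ ⟩
      card cs X + card cs Y + (extra inG + extra (not ∘ inG))     ≤⟨ +-monoʳ-≤ (card cs X + card cs Y) extra≤m ⟩
      card cs X + card cs Y + m                                    ∎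
      where open ≤-Reasoning

  rainbow-bounds : (∀ z → Inverse.to (g zero) z ≡ z) → ∀ {a s} → a ≤ N + m →
                   Rainbow (suc q) Vertex (N + m) (collection a) s → RainbowBounds a s
  rainbow-bounds g₀≗id a≤n R = record
    { X       = X
    ; y       = card cs Y
    ; x≤a     = ≤-trans (m≤m+n (card cs X) (extra inG))
                  (≤-trans (≤-reflexive (sym (count≡card+extra inG index-injectiveᴳ))) count-inG≤a)
    ; y+a≤n   = ≤-trans (+-monoˡ-≤ _ (≤-trans (m≤m+n (card cs Y) (extra (not ∘ inG)))
                  (≤-reflexive (sym (count≡card+extra (not ∘ inG) index-injectiveᶠ))))) count-not-inG+a≤n
    ; s≤x+y+m = s≤x+y+m
    ; x+y+∂≤N = x+y+∂≤N
    }
    where open Analysis g₀≗id a≤n R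

balanced-square : ∀ {N x w B} → x + w ≡ N → N ≤ 2 * x + B → N ≤ 2 * w + B → N * N ≤ 4 * (x * w) + B * N
balanced-square {N} {x} {w} {B} x+w≡N N≤2x+B N≤2w+B =
  [ (λ x≤w → ordered {x} {w} N≤2x+B (N≤2*larger x≤w x+w≡N))
  , (λ w≤x → subst (λ t → N * N ≤ 4 * t + B * N) (*-comm w x)
                   (ordered {w} {x} N≤2w+B (N≤2*larger w≤x (trans (+-comm w x) x+w≡N)))) ]′ (≤-total x w)
  where
  N≤2*larger : ∀ {u v} → u ≤ v → u + v ≡ N → N ≤ 2 * v
  N≤2*larger {u} {v} u≤v refl = ≤-trans (+-monoˡ-≤ v u≤v) (≤-reflexive (cong (v +_) (sym (+-identityʳ v))))
  shuffle : ∀ u v → 2 * u * (2 * v) ≡ 4 * (u * v)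
  shuffle = solve-∀
  ordered : ∀ {u v} → N ≤ 2 * u + B → N ≤ 2 * v → N * N ≤ 4 * (u * v) + B * N
  ordered {u} {v} N≤2u+B N≤2v = begin
    N * N                    ≤⟨ *-monoˡ-≤ N N≤2u+B ⟩
    (2 * u + B) * N          ≡⟨ *-distribʳ-+ N (2 * u) B ⟩
    2 * u * N + B * N        ≤⟨ +-monoˡ-≤ (B * N) (*-monoʳ-≤ (2 * u) N≤2v) ⟩
    2 * u * (2 * v) + B * N  ≡⟨ cong (_+ B * N) (shuffle u v) ⟩
    4 * (u * v) + B * N      ∎
    where open ≤-Reasoning

n*n≤n*m⇒n≤m : ∀ n {m} → n * n ≤ n * m → n ≤ m
n*n≤n*m⇒n≤m zero          _ = z≤n
n*n≤n*m⇒n≤m n@(suc _) n*n≤n*m = *-cancelˡ-≤ n n*n≤n*m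

x+y+R≤N⇒R≤T : ∀ {N m s T x y R} → s + T ≡ N + m → s ≤ x + y + m → x + y + R ≤ N → R ≤ T
x+y+R≤N⇒R≤T {N} {m} {s} {T} {x} {y} {R} s+T≡n s≤x+y+m x+y+R≤N = +-cancelˡ-≤ (x + y + m) R T (begin
  x + y + m + R   ≡⟨ rearrange x y m R ⟩
  x + y + R + m   ≤⟨ +-monoˡ-≤ m x+y+R≤N ⟩
  N + m           ≡⟨ s+T≡n ⟨
  s + T           ≤⟨ +-monoˡ-≤ T s≤x+y+m ⟩
  x + y + m + T   ∎)
  where
  open ≤-Reasoning
  rearrange : ∀ x y m R → x + y + m + R ≡ x + y + R + m
  rearrange = solve-∀

-- The colour classes have sizes ⌊n/2⌋ and ⌈n/2⌉, so x and w = N - x are both at least (N - B)/2.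
N≤2x+B×N≤2w+B : ∀ {N m s T x y w a} → s + T ≡ N + m → s ≤ x + y + m → x ≤ a → y + a ≤ N + m →
                2 * a ≤ N + m → N + m ≤ suc (2 * a) → x + w ≡ N →
                let B = m + 2 * T + 1 in N ≤ 2 * x + B × N ≤ 2 * w + B
N≤2x+B×N≤2w+B {m = m} {s} {T} {x} {y} {w} {a} s+T≡n s≤x+y+m x≤a y+a≤n 2a≤n n≤1+2a refl = N≤2x+B , N≤2w+B
  where
  open ≤-Reasoning
  N = x + w
  B = m + 2 * T + 1
  a≤x+m+T : a ≤ x + m + T
  a≤x+m+T = +-cancelˡ-≤ y a (x + m + T) (begin
    y + a           ≤⟨ y+a≤n ⟩
    N + m           ≡⟨ s+T≡n ⟨
    s + T           ≤⟨ +-monoˡ-≤ T s≤x+y+m ⟩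
    x + y + m + T   ≡⟨ rearrange x y m T ⟩
    y + (x + m + T) ∎)
    where
    rearrange : ∀ x y m T → x + y + m + T ≡ y + (x + m + T)
    rearrange = solve-∀
  N≤2x+B : N ≤ 2 * x + B
  N≤2x+B = +-cancelʳ-≤ m N (2 * x + B) (begin
    N + m                 ≤⟨ n≤1+2a ⟩
    suc (2 * a)           ≤⟨ s≤s (*-monoʳ-≤ 2 a≤x+m+T) ⟩
    suc (2 * (x + m + T)) ≡⟨ expand x m T ⟩
    2 * x + B + m         ∎)
    where
    expand : ∀ x m T → suc (2 * (x + m + T)) ≡ 2 * x + (m + 2 * T + 1) + m
    expand = solve-∀
  N≤2w+B : N ≤ 2 * w + B
  N≤2w+B = ≤-trans (+-cancelˡ-≤ (2 * x) N (2 * w + m) (begin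
    2 * x + N             ≤⟨ +-monoˡ-≤ N (≤-trans (*-monoʳ-≤ 2 x≤a) 2a≤n) ⟩
    N + m + N             ≡⟨ expand x w m ⟩
    2 * x + (2 * w + m)   ∎))
    (+-monoʳ-≤ (2 * w) (≤-trans (m≤m+n m (2 * T)) (m≤m+n (m + 2 * T) 1)))
    where
    expand : ∀ x w m → x + w + m + (x + w) ≡ 2 * x + (2 * w + m)
    expand = solve-∀

grid-volume-bound : ∀ {N m s T x y w a R c} →
  s + T ≡ N + m → s ≤ x + y + m → x ≤ a → y + a ≤ N + m → 2 * a ≤ N + m → N + m ≤ suc (2 * a) →
  x + w ≡ N → x + y + R ≤ N → 4 * (x * w) ≤ N * (c * R) → N ≤ c * T + (m + 2 * T + 1)
grid-volume-bound {N} {m} {s} {T} {x} {y} {w} {a} {R} {c} s+T≡n s≤x+y+m x≤a y+a≤n 2a≤n n≤1+2a x+w≡N x+y+R≤N 4xw≤NcR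
  with N≤2x+B , N≤2w+B ← N≤2x+B×N≤2w+B {N} {m} {s} {T} {x} {y} {w} {a} s+T≡n s≤x+y+m x≤a y+a≤n 2a≤n n≤1+2a x+w≡N =
  n*n≤n*m⇒n≤m N (begin
    N * N                  ≤⟨ balanced-square {N} {x} {w} {B} x+w≡N N≤2x+B N≤2w+B ⟩
    4 * (x * w) + B * N    ≤⟨ +-monoˡ-≤ (B * N) (≤-trans 4xw≤NcR (*-monoʳ-≤ N (*-monoʳ-≤ c R≤T))) ⟩
    N * (c * T) + B * N    ≡⟨ factor N (c * T) B ⟩
    N * (c * T + B)        ∎)
  where
  open ≤-Reasoning
  B = m + 2 * T + 1
  R≤T : R ≤ T
  R≤T = x+y+R≤N⇒R≤T {N} {m} {s} {T} {x} {y} {R} s+T≡n s≤x+y+m x+y+R≤N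
  factor : ∀ N q b → N * q + b * N ≡ N * (q + b)
  factor = solve-∀

18[1+k][r+4]≤49rk : ∀ {k r} → 6 ≤ k → 3 ≤ r → 18 * (suc k * (r + 4)) ≤ 49 * (r * k)
18[1+k][r+4]≤49rk {k} {r} 6≤k 3≤r = begin
  18 * (suc k * (r + 4))      ≡⟨ regroup k r ⟩
  6 * suc k * (3 * (r + 4))   ≤⟨ *-mono-≤ 6[1+k]≤7k 3[r+4]≤7r ⟩
  7 * k * (7 * r)             ≡⟨ regroup′ k r ⟩
  49 * (r * k)                ∎
  where
  open ≤-Reasoning
  regroup : ∀ k r → 18 * (suc k * (r + 4)) ≡ 6 * suc k * (3 * (r + 4))
  regroup = solve-∀
  regroup′ : ∀ k r → 7 * k * (7 * r) ≡ 49 * (r * k)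
  regroup′ = solve-∀
  6[1+k]≤7k : 6 * suc k ≤ 7 * k
  6[1+k]≤7k = subst (_≤ 7 * k) (sym (*-suc 6 k)) (+-monoˡ-≤ (6 * k) 6≤k)
  3[r+4]≤7r : 3 * (r + 4) ≤ 7 * r
  3[r+4]≤7r = subst₂ _≤_ (sym (*-distribˡ-+ 3 r 4)) (sym (*-distribʳ-+ r 3 4)) (+-monoʳ-≤ (3 * r) (*-monoʳ-≤ 4 3≤r))

-- Multiplied out: 270 n ≤ 1785 r k T + 630, and 630 ≤ 3n.
linear-bound : ∀ {N m k r T} → 5 * (N + m) ≤ 7 * N → 6 ≤ k → 3 ≤ r → 216 ≤ N + m →
               N ≤ suc k * (r + 4) * T + (m + 2 * T + 1) → N + m ≤ T * (12 * r) * k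
linear-bound {N} {m} {k} {r} {T} 5n≤7N 6≤k 3≤r 216≤n N≤Q+B =
  *-cancelˡ-≤ 267 (+-cancelʳ-≤ (3 * n) (267 * n) (267 * (T * (12 * r) * k)) (begin
    267 * n + 3 * n                   ≡⟨ 267n+3n≡54[5n] n ⟩
    54 * (5 * n)                      ≤⟨ *-monoʳ-≤ 54 5n≤7N ⟩
    54 * (7 * N)                      ≡⟨ 54[7N]≡126[3N] N ⟩
    126 * (3 * N)                     ≤⟨ *-monoʳ-≤ 126 3N≤5Q+10T+5 ⟩
    126 * (5 * Q + 10 * T + 5)        ≡⟨ distribute Q T ⟩
    35 * (18 * Q) + 70 * (18 * T) + 630
      ≤⟨ +-mono-≤ (+-mono-≤ (*-monoʳ-≤ 35 18Q≤49P) (*-monoʳ-≤ 70 18T≤P)) (≤-trans (m≤m+n 630 18) (*-monoʳ-≤ 3 216≤n)) ⟩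
    35 * (49 * P) + 70 * P + 3 * n    ≡⟨ cong (_+ 3 * n) (35[49P]+70P≡1785P P) ⟩
    1785 * P + 3 * n                  ≤⟨ +-monoˡ-≤ (3 * n) (*-monoˡ-≤ P (m≤m+n 1785 1419)) ⟩
    3204 * P + 3 * n                  ≡⟨ cong (_+ 3 * n) (3204P≡267[T[12r]k] r k T) ⟩
    267 * (T * (12 * r) * k) + 3 * n  ∎))
  where
  open ≤-Reasoning
  n = N + m
  P = r * k * T
  Q = suc k * (r + 4) * T
  267n+3n≡54[5n] : ∀ n → 267 * n + 3 * n ≡ 54 * (5 * n)
  267n+3n≡54[5n] = solve-∀
  54[7N]≡126[3N] : ∀ N → 54 * (7 * N) ≡ 126 * (3 * N)
  54[7N]≡126[3N] = solve-∀
  distribute : ∀ Q T → 126 * (5 * Q + 10 * T + 5) ≡ 35 * (18 * Q) + 70 * (18 * T) + 630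
  distribute = solve-∀
  35[49P]+70P≡1785P : ∀ P → 35 * (49 * P) + 70 * P ≡ 1785 * P
  35[49P]+70P≡1785P = solve-∀
  3204P≡267[T[12r]k] : ∀ r k T → 3204 * (r * k * T) ≡ 267 * (T * (12 * r) * k)
  3204P≡267[T[12r]k] = solve-∀
  5m≤2N : 5 * m ≤ 2 * N
  5m≤2N = +-cancelˡ-≤ (5 * N) (5 * m) (2 * N) (begin
    5 * N + 5 * m   ≡⟨ *-distribˡ-+ 5 N m ⟨
    5 * n           ≤⟨ 5n≤7N ⟩
    7 * N           ≡⟨ *-distribʳ-+ N 5 2 ⟩
    5 * N + 2 * N   ∎)
  3N≤5Q+10T+5 : 3 * N ≤ 5 * Q + 10 * T + 5
  3N≤5Q+10T+5 = +-cancelʳ-≤ (2 * N) (3 * N) (5 * Q + 10 * T + 5) (begin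
    3 * N + 2 * N                ≡⟨ *-distribʳ-+ N 3 2 ⟨
    5 * N                        ≤⟨ *-monoʳ-≤ 5 N≤Q+B ⟩
    5 * (Q + (m + 2 * T + 1))    ≡⟨ expand Q m T ⟩
    5 * Q + 10 * T + 5 + 5 * m   ≤⟨ +-monoʳ-≤ (5 * Q + 10 * T + 5) 5m≤2N ⟩
    5 * Q + 10 * T + 5 + 2 * N   ∎)
    where
    expand : ∀ Q m T → 5 * (Q + (m + 2 * T + 1)) ≡ 5 * Q + 10 * T + 5 + 5 * m
    expand = solve-∀
  18Q≤49P : 18 * Q ≤ 49 * P
  18Q≤49P = begin
    18 * Q                        ≡⟨ *-assoc 18 (suc k * (r + 4)) T ⟨
    18 * (suc k * (r + 4)) * T    ≤⟨ *-monoˡ-≤ T (18[1+k][r+4]≤49rk 6≤k 3≤r) ⟩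
    49 * (r * k) * T              ≡⟨ *-assoc 49 (r * k) T ⟩
    49 * P                        ∎
  18T≤P : 18 * T ≤ P
  18T≤P = *-monoˡ-≤ T (*-mono-≤ 3≤r 6≤k)

^-distribʳ-* : ∀ a b e → (a * b) ^ e ≡ a ^ e * b ^ e
^-distribʳ-* a b zero    = refl
^-distribʳ-* a b (suc e) = trans (cong (a * b *_) (^-distribʳ-* a b e)) (*-interchange a b (a ^ e) (b ^ e))

n^r≤T^[1+r] : ∀ {n T k} r → 1 ≤ n → n ≤ T * k → k ^ suc r ≤ n → n ^ r ≤ T ^ suc r
n^r≤T^[1+r] {n} {T} {k} r 1≤n n≤Tk k^[1+r]≤n = *-cancelʳ-≤ (n ^ r) (T ^ suc r) n {{>-nonZero 1≤n}} (begin
  n ^ r * n               ≡⟨ *-comm (n ^ r) n ⟩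
  n ^ suc r               ≤⟨ ^-monoˡ-≤ (suc r) n≤Tk ⟩
  (T * k) ^ suc r         ≡⟨ ^-distribʳ-* T k (suc r) ⟩
  T ^ suc r * k ^ suc r   ≤⟨ *-monoʳ-≤ (T ^ suc r) k^[1+r]≤n ⟩
  T ^ suc r * n           ∎)
  where open ≤-Reasoning

⌊n/2⌋-bounds : ∀ n → 2 * ⌊ n /2⌋ ≤ n × n ≤ suc (2 * ⌊ n /2⌋)
⌊n/2⌋-bounds zero          = z≤n , z≤n
⌊n/2⌋-bounds (suc zero)    = z≤n , ≤-refl
⌊n/2⌋-bounds (suc (suc n)) with lower , upper ← ⌊n/2⌋-bounds n =
  subst (_≤ 2 + n) (sym (*-suc 2 ⌊ n /2⌋)) (s≤s (s≤s lower)) ,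
  subst (2 + n ≤_) (sym (cong suc (*-suc 2 ⌊ n /2⌋))) (s≤s (s≤s upper))

-- Choice of the torus

last-satisfying : (P : ℕ → Set) → Decidable P → ∀ L → P 0 → ∃[ j ] P j × (j ≡ L ⊎ j < L × ¬ P (suc j))
last-satisfying P P? zero    P₀ = 0 , P₀ , inj₁ refl
last-satisfying P P? (suc L) P₀ with P? 1
... | no ¬P₁ = 0 , P₀ , inj₂ (z<s , ¬P₁)
... | yes P₁ with j , Pj , last ← last-satisfying (P ∘ suc) (P? ∘ suc) L P₁ =
  suc j , Pj , Sum.map (cong suc) (Product.map s≤s id) last

m≤m^[1+n] : ∀ m n → m ≤ m ^ suc n
m≤m^[1+n] zero      n = z≤n
m≤m^[1+n] m@(suc _) n = m≤m*n m (m ^ n) {{m^n≢0 m n}}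

integer-root : ∀ r n → 6 ^ suc r ≤ n → ∃[ k ] 6 ≤ k × k ^ suc r ≤ n × n < suc k ^ suc r
integer-root r n 6^r≤n with last-satisfying (λ j → (6 + j) ^ suc r ≤ n) (λ j → (6 + j) ^ suc r ≤? n) n 6^r≤n
... | j , [6+j]^r≤n , inj₂ (_ , [7+j]^r≰n) = 6 + j , m≤m+n 6 j , [6+j]^r≤n , ≰⇒> [7+j]^r≰n
... | j , [6+j]^r≤n , inj₁ refl = contradiction [6+j]^r≤n (<⇒≱ (≤-trans (m≤n+m (suc j) 5) (m≤m^[1+n] (6 + j) r)))

even-side : ∀ k → 6 ≤ k → ∃[ c ] parity (fromℕ c) ≡ true × suc c ≤ k × 5 * suc k ≤ 7 * suc c
even-side k 6≤k with o , refl ← m≤n⇒∃[o]m+o≡n 6≤k | parity (fromℕ (5 + o)) in last-odd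
... | true  = 5 + o , last-odd , ≤-refl , ≤-trans (m≤m+n _ (7 + 2 * o)) (≤-reflexive (slack o))
  where
  slack : ∀ o → 5 * (7 + o) + (7 + 2 * o) ≡ 7 * (6 + o)
  slack = solve-∀
... | false = 4 + o , not-injective last-odd , n≤1+n _ , ≤-trans (m≤m+n _ (2 * o)) (≤-reflexive (slack o))
  where
  slack : ∀ o → 5 * (7 + o) + 2 * o ≡ 7 * (5 + o)
  slack = solve-∀

-- The first j of the L cycles have length κ + 2, the others κ + 1.
sides : ℕ → (L j : ℕ) → Vec ℕ L
sides κ zero    j       = []
sides κ (suc L) zero    = κ ∷ sides κ L zero
sides κ (suc L) (suc j) = suc κ ∷ sides κ L j

volume-sides-zero : ∀ κ L → volume (sides κ L zero) ≡ suc κ ^ L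
volume-sides-zero κ zero    = refl
volume-sides-zero κ (suc L) = cong (suc κ *_) (volume-sides-zero κ L)

volume-sides-all : ∀ κ L → volume (sides κ L L) ≡ suc (suc κ) ^ L
volume-sides-all κ zero    = refl
volume-sides-all κ (suc L) = cong (suc (suc κ) *_) (volume-sides-all κ L)

volume-sides-suc : ∀ κ {L j} → j < L → suc κ * volume (sides κ L (suc j)) ≡ suc (suc κ) * volume (sides κ L j)
volume-sides-suc κ {suc L} {zero}  _         = *-left-comm (suc κ) (suc (suc κ)) (volume (sides κ L zero))
volume-sides-suc κ {suc L} {suc j} (s≤s j<L) =
  trans (*-left-comm (suc κ) (suc (suc κ)) (volume (sides κ L (suc j)))) (cong (suc (suc κ) *_) (volume-sides-suc κ j<L))

sides-bounded : ∀ κ L j → All (λ c → suc c ≤ suc (suc κ)) (sides κ L j)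
sides-bounded κ zero    j       = []
sides-bounded κ (suc L) zero    = n≤1+n _ ∷ sides-bounded κ L zero
sides-bounded κ (suc L) (suc j) = ≤-refl ∷ sides-bounded κ L j

record Parameters (r′ n : ℕ) : Set where
  field
    k c₀ c₁ c₂ : ℕ
    cs         : Vec ℕ r′
    6≤k        : 6 ≤ k
    k^r≤n      : k ^ (3 + r′) ≤ n
    c₀-odd     : parity (fromℕ c₀) ≡ true
    bounded    : All (λ c → suc c ≤ suc k) (c₀ ∷ c₁ ∷ c₂ ∷ cs)
    N≤n        : volume (c₀ ∷ c₁ ∷ c₂ ∷ cs) ≤ n
    5n≤7N      : 5 * n ≤ 7 * volume (c₀ ∷ c₁ ∷ c₂ ∷ cs)

-- Lengthening a later cycle from k to k + 1 multiplies the volume by (k + 1)/k ≤ 7/6, and the even first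
-- length e has 5(k + 1) ≤ 7e; so the last volume that still fits below n is at least 5n/7.
last-fitting-volume : ∀ {n κ e L j} → let k = suc κ in n < suc k ^ suc L → e ≤ k → 5 * suc k ≤ 7 * e →
                      j ≡ L ⊎ j < L × ¬ (e * volume (sides κ L (suc j)) ≤ n) →
                      5 * n ≤ 7 * (e * volume (sides κ L j))
last-fitting-volume {n} {κ} {e} {L} n<[1+k]^r e≤k 5[1+k]≤7e (inj₁ refl) = begin
  5 * n                            ≤⟨ *-monoʳ-≤ 5 (<⇒≤ n<[1+k]^r) ⟩
  5 * (suc k * suc k ^ L)          ≡⟨ *-assoc 5 (suc k) (suc k ^ L) ⟨
  5 * suc k * suc k ^ L            ≤⟨ *-monoˡ-≤ (suc k ^ L) 5[1+k]≤7e ⟩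
  7 * e * suc k ^ L                ≡⟨ *-assoc 7 e (suc k ^ L) ⟩
  7 * (e * suc k ^ L)              ≡⟨ cong (λ V → 7 * (e * V)) (volume-sides-all κ L) ⟨
  7 * (e * volume (sides κ L L))   ∎
  where
  open ≤-Reasoning
  k = suc κ
last-fitting-volume {n} {κ} {e} {L} {j} _ e≤k 5[1+k]≤7e (inj₂ (j<L , eV′≰n)) = *-cancelˡ-≤ k (begin
  k * (5 * n)                ≡⟨ *-left-comm k 5 n ⟩
  5 * (k * n)                ≤⟨ *-monoʳ-≤ 5 (*-monoʳ-≤ k (<⇒≤ (≰⇒> eV′≰n))) ⟩
  5 * (k * (e * V′))         ≡⟨ cong (5 *_) (*-left-comm k e V′) ⟩
  5 * (e * (k * V′))         ≡⟨ cong (λ t → 5 * (e * t)) (volume-sides-suc κ j<L) ⟩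
  5 * (e * (suc k * V))      ≡⟨ regroup e (suc k) V ⟩
  5 * suc k * (e * V)        ≤⟨ *-monoˡ-≤ (e * V) (≤-trans 5[1+k]≤7e (*-monoʳ-≤ 7 e≤k)) ⟩
  7 * k * (e * V)            ≡⟨ regroup′ k (e * V) ⟩
  k * (7 * (e * V))          ∎)
  where
  open ≤-Reasoning
  k = suc κ
  V = volume (sides κ L j)
  V′ = volume (sides κ L (suc j))
  regroup : ∀ e k V → 5 * (e * (k * V)) ≡ 5 * k * (e * V)
  regroup = solve-∀
  regroup′ : ∀ k x → 7 * k * x ≡ k * (7 * x)
  regroup′ = solve-∀

parameters : ∀ r′ n → 6 ^ (3 + r′) < n → Parameters r′ n
parameters r′ n 6^r<n with integer-root (2 + r′) n (<⇒≤ 6^r<n)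
... | suc κ , 6≤k , k^r≤n , n<[1+k]^r with even-side (suc κ) 6≤k
... | c₀ , c₀-odd , e≤k , 5[1+k]≤7e = fit (last-satisfying P (λ j → e * volume (sides κ L j) ≤? n) L eV₀≤n)
  where
  open ≤-Reasoning
  k = suc κ
  L = 2 + r′
  e = suc c₀
  P : ℕ → Set
  P j = e * volume (sides κ L j) ≤ n
  eV₀≤n : P 0
  eV₀≤n = begin
    e * volume (sides κ L zero)   ≡⟨ cong (e *_) (volume-sides-zero κ L) ⟩
    e * k ^ L                     ≤⟨ *-monoˡ-≤ (k ^ L) e≤k ⟩
    k ^ (3 + r′)                  ≤⟨ k^r≤n ⟩
    n                             ∎
  package : (v : Vec ℕ L) → All (λ c → suc c ≤ suc k) v → e * volume v ≤ n → 5 * n ≤ 7 * (e * volume v) →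
            Parameters r′ n
  package (c₁ ∷ c₂ ∷ cs) bounded N≤n 5n≤7N = record
    { k = k ; c₀ = c₀ ; c₁ = c₁ ; c₂ = c₂ ; cs = cs ; 6≤k = 6≤k ; k^r≤n = k^r≤n ; c₀-odd = c₀-odd
    ; bounded = ≤-trans e≤k (n≤1+n k) ∷ bounded ; N≤n = N≤n ; 5n≤7N = 5n≤7N }
  fit : ∃[ j ] P j × (j ≡ L ⊎ j < L × ¬ P (suc j)) → Parameters r′ n
  fit (j , eV≤n , last) = package (sides κ L j) (sides-bounded κ L j) eV≤n
                                  (last-fitting-volume n<[1+k]^r e≤k 5[1+k]≤7e last)

module Construction {r′ n} (p : Parameters r′ n) where
  open Parameters p public

  r : ℕ
  r = 3 + r′

  G : Vec ℕ r
  G = c₀ ∷ c₁ ∷ c₂ ∷ cs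

  moves : Fin r → Grid G ↔ Grid G
  moves zero                = ↔-refl
  moves (suc zero)          = shift↔ G zero
  moves (suc (suc zero))    = diagonal↔ parity
  moves (suc (suc (suc i))) = shift↔ G (suc (suc (suc i)))

  open TorusCollection G (n ∸ volume G) moves public

  m : ℕ
  m = n ∸ N

  N+m≡n : N + m ≡ n
  N+m≡n = m+[n∸m]≡n N≤n

  216≤n : 216 ≤ n
  216≤n = ≤-trans (^-monoʳ-≤ 6 {3} {r} (s≤s (s≤s (s≤s z≤n)))) (≤-trans (^-monoˡ-≤ r 6≤k) k^r≤n)

  ∂ᵀ≤[r+4]R : ∀ X {R} → (∀ i → ∂ G (Inverse.to (moves i)) X ≤ R) → ∂ᵀ G X ≤ (r + 4) * R
  ∂ᵀ≤[r+4]R X {R} ∂≤R = begin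
    ∂ᵀ G X
      ≡⟨ cong (∂ G (shift G zero) X +_) (sym (+-assoc (∂ G (shift G (suc zero)) X) _ _)) ⟩
    ∂ G (shift G zero) X + ((∂ G (shift G (suc zero)) X + ∂ G (shift G (suc (suc zero))) X)
                            + ∑[ i < r′ ] ∂ G (shift G (suc (suc (suc i)))) X)
      ≤⟨ +-monoʳ-≤ (∂ G (shift G zero) X) (+-monoˡ-≤ _ (∂₁+∂₂≤2∂diagonal+4∂₀ cs (parity-alternating c₀-odd) X)) ⟩
    ∂ G (shift G zero) X + ((2 * ∂ G (Inverse.to (diagonal↔ parity)) X + 4 * ∂ G (shift G zero) X)
                            + ∑[ i < r′ ] ∂ G (shift G (suc (suc (suc i)))) X)
      ≤⟨ +-mono-≤ (∂≤R (suc zero))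
                  (+-mono-≤ (+-mono-≤ (*-monoʳ-≤ 2 (∂≤R (suc (suc zero)))) (*-monoʳ-≤ 4 (∂≤R (suc zero))))
                            (∑-mono-≤ (λ i → ∂≤R (suc (suc (suc i)))))) ⟩
    R + ((2 * R + 4 * R) + ∑[ i < r′ ] R)
      ≡⟨ cong (λ t → R + ((2 * R + 4 * R) + t)) (∑-const r′ R) ⟩
    R + ((2 * R + 4 * R) + r′ * R)
      ≡⟨ collect R r′ ⟩
    (r + 4) * R ∎
    where
    open ≤-Reasoning
    collect : ∀ R r′ → R + ((2 * R + 4 * R) + r′ * R) ≡ (3 + r′ + 4) * R
    collect = solve-∀

  rainbow-deficit : ∀ {s} → Rainbow r Vertex (N + m) (collection ⌊ (N + m) /2⌋) s →
                    N + m ≤ ((N + m) ∸ s) * (12 * r) * k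
  rainbow-deficit {s} rainbow = linear-bound {N} {m} {k} {r} {T}
    (subst (λ n → 5 * n ≤ 7 * N) (sym N+m≡n) 5n≤7N) 6≤k (s≤s (s≤s (s≤s z≤n))) (subst (216 ≤_) (sym N+m≡n) 216≤n)
    (grid-volume-bound {N} {m} {s} {T} {x} {y} {card G (not ∘ X)} {⌊ (N + m) /2⌋} {R} {suc k * (r + 4)}
       (m+[n∸m]≡n s≤n) s≤x+y+m x≤a y+a≤n 2a≤n n≤1+2a (count+count∘not≡n (X ∘ decode G)) (≤-reflexive x+y+R≡N) iso)
    where
    open RainbowBounds (rainbow-bounds (λ _ → refl) (⌊n/2⌋≤n (N + m)) rainbow)
    x = card G X
    T = (N + m) ∸ s
    R = N ∸ (x + y)
    s≤n : s ≤ N + m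
    s≤n = Finₚ.injective⇒≤ (Rainbow.colourInj rainbow)
    2a≤n = proj₁ (⌊n/2⌋-bounds (N + m))
    n≤1+2a = proj₂ (⌊n/2⌋-bounds (N + m))
    x+y+R≡N : x + y + R ≡ N
    x+y+R≡N = m+[n∸m]≡n (≤-trans (m≤m+n (x + y) _) (x+y+∂≤N zero))
    ∂≤R : ∀ i → ∂ G (Inverse.to (moves i)) X ≤ R
    ∂≤R i = m+n≤o⇒m≤o∸n _ (subst (_≤ N) (+-comm (x + y) _) (x+y+∂≤N i))
    iso : 4 * (x * card G (not ∘ X)) ≤ N * (suc k * (r + 4) * R)
    iso = begin
      4 * (x * card G (not ∘ X))       ≤⟨ torus-isoperimetric (suc k) G bounded X ⟩
      N * (suc k * ∂ᵀ G X)             ≤⟨ *-monoʳ-≤ N (*-monoʳ-≤ (suc k) (∂ᵀ≤[r+4]R X ∂≤R)) ⟩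
      N * (suc k * ((r + 4) * R))      ≡⟨ cong (N *_) (*-assoc (suc k) (r + 4) R) ⟨
      N * (suc k * (r + 4) * R)        ∎
      where open ≤-Reasoning

  below-bound : ∀ {s} → Admits r n s → BelowBound r n s
  below-bound {s} admits = s≤n , n^r≤T^[1+r] {n} {(n ∸ s) * (12 * r)} {k} (2 + r′) (≤-trans (s≤s z≤n) 216≤n) n≤Tk k^r≤n
    where
    rainbow : Rainbow r Vertex (N + m) (collection ⌊ (N + m) /2⌋) s
    rainbow = subst (λ n → Admits r n s) (sym N+m≡n) admits Vertex (collection ⌊ (N + m) /2⌋)
    s≤n : s ≤ n
    s≤n = subst (s ≤_) N+m≡n (Finₚ.injective⇒≤ (Rainbow.colourInj rainbow))
    n≤Tk : n ≤ (n ∸ s) * (12 * r) * k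
    n≤Tk = subst (λ n → n ≤ (n ∸ s) * (12 * r) * k) N+m≡n (rainbow-deficit rainbow)

theorem1p7 : (r n : ℕ) → 3 ≤ r → 6 ^ r < n →
    (s : ℕ) → Admits r n s → BelowBound r n s
theorem1p7 (suc (suc (suc r′))) n (s≤s (s≤s (s≤s z≤n))) 6^r<n s =
  Construction.below-bound (parameters r′ n 6^r<n)
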